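{- For every formula $A$ of $\mathbf{IQC}$: if $\vdash_{\mathbf{IQC}} A$ then $\vdash_{\mathbf{EQC}} A^{\Box_{\mathbf{RS}}}$. Likewise, for every formula $A$ of the language of arithmetic: if $\vdash_{\mathbf{HA}} A$ then $\vdash_{\mathbf{EA}} A^{\Box_{\mathbf{RS}}}$.
   Context: $\mathbf{IQC}$ is intuitionistic first-order predicate calculus with equality, with primitives $\vee,\wedge,\supset,\exists,\forall$ and the constant $\bot$; $\neg A$ abbreviates $A\supset\bot$. $\mathbf{EQC}$ is classical first-order predicate calculus with equality extended by a modal operator $\Box$ governed by the S4 rules ($\Box$-introduction: from $A$ infer $\Box A$ provided all open assumptions have the form $\Box B$; $\Box$-elimination: from $\Box A$ infer $A$); no Barcan formula is assumed. $\mathbf{HA}$ is Heyting arithmetic (language $0,s,+,\cdot$; axioms for zero and successor, defining equations of $+,\cdot$, induction for all formulas) over $\mathbf{IQC}$. $\mathbf{EA}$ (Shapiro's epistemic arithmetic) is the same arithmetic axioms, with induction for all formulas of the modal language, over $\mathbf{EQC}$ (i.e. $\mathbf{PA}$ plus S4). The modified Rasiowa–Sikorski translation $A\mapsto A^{\Box_{\mathbf{RS}}}$ is defined by induction on $A$: (i) if $A$ is $\bot$ or an equation $s=t$, $A^{\Box_{\mathbf{RS}}}=A$; (ii) if $A$ is any other atomic formula, $A^{\Box_{\mathbf{RS}}}=\Box A$; (iii) $(A\vee B)^{\Box_{\mathbf{RS}}}=\Box A^{\Box_{\mathbf{RS}}}\vee\Box B^{\Box_{\mathbf{RS}}}$;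 (iv) $(A\wedge B)^{\Box_{\mathbf{RS}}}=A^{\Box_{\mathbf{RS}}}\wedge B^{\Box_{\mathbf{RS}}}$; (v) $(A\supset B)^{\Box_{\mathbf{RS}}}=\Box(\Box A^{\Box_{\mathbf{RS}}}\supset\Box B^{\Box_{\mathbf{RS}}})$; (vi) $(\exists x A)^{\Box_{\mathbf{RS}}}=\exists x\,\Box A^{\Box_{\mathbf{RS}}}$; (vii) $(\forall x A)^{\Box_{\mathbf{RS}}}=\forall x\,A^{\Box_{\mathbf{RS}}}$. -}

module Defs where

open import Data.Nat using (ℕ; zero; suc)
open import Data.Empty using (⊥)
open import Data.Vec using (Vec; []; _∷_)
open import Data.List using (List; []; _∷_; map)
open import Data.List.Membership.Propositional using (_∈_)
open import Data.List.Relation.Unary.All using (All)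

-- First-order signatures (function and predicate symbols with arities).
-- Equality is a logical primitive, not a predicate symbol.

record Signature : Set₁ where
  field
    Fun       : Set
    funArity  : Fun → ℕ
    Pred      : Set
    predArity : Pred → ℕ
open Signature public

-- Terms, with de Bruijn-indexed variables.

data Term (S : Signature) : Set where
  var : ℕ → Term S
  app : (f : Fun S) → Vec (Term S) (funArity S f) → Term S

Subst : Signature → Set
Subst S = ℕ → Term S

mutual
  tsub : ∀ {S} → Subst S → Term S → Term S
  tsub σ (var n)    = σ n
  tsub σ (app f ts) = app f (tsubs σ ts)

  tsubs : ∀ {S n} → Subst S → Vec (Term S) n → Vec (Term S) n
  tsubs σ []       = []
  tsubs σ (t ∷ ts) = tsub σ t ∷ tsubs σ ts

liftσ : ∀ {S} → Subst S → Subst S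
liftσ σ zero    = var zero
liftσ σ (suc n) = tsub (λ k → var (suc k)) (σ n)

-- Formulas.  'plain' = language of IQC (no box); 'modal' = language of EQC.

data Mode : Set where
  plain modal : Mode

infixr 6 _∧ᶠ_
infixr 5 _∨ᶠ_
infixr 4 _⊃_
infix  8 _≐_

data Fm (S : Signature) : Mode → Set where
  ⊥ᶠ   : ∀ {m} → Fm S m
  _≐_  : ∀ {m} → Term S → Term S → Fm S m
  rel  : ∀ {m} (P : Pred S) → Vec (Term S) (predArity S P) → Fm S m
  _∧ᶠ_ : ∀ {m} → Fm S m → Fm S m → Fm S m
  _∨ᶠ_ : ∀ {m} → Fm S m → Fm S m → Fm S m
  _⊃_  : ∀ {m} → Fm S m → Fm S m → Fm S m
  ∀ᶠ   : ∀ {m} → Fm S m → Fm S m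
  ∃ᶠ   : ∀ {m} → Fm S m → Fm S m
  □_   : Fm S modal → Fm S modal

¬ᶠ_ : ∀ {S m} → Fm S m → Fm S m
¬ᶠ A = A ⊃ ⊥ᶠ

fsub : ∀ {S m} → Subst S → Fm S m → Fm S m
fsub σ ⊥ᶠ         = ⊥ᶠ
fsub σ (s ≐ t)    = tsub σ s ≐ tsub σ t
fsub σ (rel P ts) = rel P (tsubs σ ts)
fsub σ (A ∧ᶠ B)   = fsub σ A ∧ᶠ fsub σ B
fsub σ (A ∨ᶠ B)   = fsub σ A ∨ᶠ fsub σ B
fsub σ (A ⊃ B)    = fsub σ A ⊃ fsub σ B
fsub σ (∀ᶠ A)     = ∀ᶠ (fsub (liftσ σ) A)
fsub σ (∃ᶠ A)     = ∃ᶠ (fsub (liftσ σ) A)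
fsub σ (□ A)      = □ fsub σ A

shift : ∀ {S m} → Fm S m → Fm S m
shift = fsub (λ k → var (suc k))

sub0 : ∀ {S} → Term S → Subst S
sub0 t zero    = t
sub0 t (suc n) = var n

_[_] : ∀ {S m} → Fm S m → Term S → Fm S m
A [ t ] = fsub (sub0 t) A

-- IQC: intuitionistic natural deduction with equality, over a set of
-- non-logical axioms Ax (available in every context).

data Dᵢ {S : Signature} (Ax : Fm S plain → Set)
       : List (Fm S plain) → Fm S plain → Set where
  hyp  : ∀ {Γ A} → A ∈ Γ → Dᵢ Ax Γ A
  ax   : ∀ {Γ A} → Ax A → Dᵢ Ax Γ A
  ⊥E   : ∀ {Γ A} → Dᵢ Ax Γ ⊥ᶠ → Dᵢ Ax Γ A
  ∧I   : ∀ {Γ A B} → Dᵢ Ax Γ A → Dᵢ Ax Γ B → Dᵢ Ax Γ (A ∧ᶠ B)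
  ∧E₁  : ∀ {Γ A B} → Dᵢ Ax Γ (A ∧ᶠ B) → Dᵢ Ax Γ A
  ∧E₂  : ∀ {Γ A B} → Dᵢ Ax Γ (A ∧ᶠ B) → Dᵢ Ax Γ B
  ∨I₁  : ∀ {Γ A B} → Dᵢ Ax Γ A → Dᵢ Ax Γ (A ∨ᶠ B)
  ∨I₂  : ∀ {Γ A B} → Dᵢ Ax Γ B → Dᵢ Ax Γ (A ∨ᶠ B)
  ∨E   : ∀ {Γ A B C} → Dᵢ Ax Γ (A ∨ᶠ B) → Dᵢ Ax (A ∷ Γ) C → Dᵢ Ax (B ∷ Γ) C
         → Dᵢ Ax Γ C
  ⊃I   : ∀ {Γ A B} → Dᵢ Ax (A ∷ Γ) B → Dᵢ Ax Γ (A ⊃ B)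
  ⊃E   : ∀ {Γ A B} → Dᵢ Ax Γ (A ⊃ B) → Dᵢ Ax Γ A → Dᵢ Ax Γ B
  ∀I   : ∀ {Γ A} → Dᵢ Ax (map shift Γ) A → Dᵢ Ax Γ (∀ᶠ A)
  ∀E   : ∀ {Γ A} (t : Term S) → Dᵢ Ax Γ (∀ᶠ A) → Dᵢ Ax Γ (A [ t ])
  ∃I   : ∀ {Γ A} (t : Term S) → Dᵢ Ax Γ (A [ t ]) → Dᵢ Ax Γ (∃ᶠ A)
  ∃E   : ∀ {Γ A B} → Dᵢ Ax Γ (∃ᶠ A) → Dᵢ Ax (A ∷ map shift Γ) (shift B)
         → Dᵢ Ax Γ B
  ≐refl : ∀ {Γ} (t : Term S) → Dᵢ Ax Γ (t ≐ t)
  ≐subst : ∀ {Γ A} {s t : Term S} → Dᵢ Ax Γ (s ≐ t) → Dᵢ Ax Γ (A [ s ])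
           → Dᵢ Ax Γ (A [ t ])

-- EQC: classical natural deduction with equality plus S4 box rules.

data IsBoxed {S : Signature} : Fm S modal → Set where
  boxed : ∀ {A} → IsBoxed (□ A)

data Dₑ {S : Signature} (Ax : Fm S modal → Set)
       : List (Fm S modal) → Fm S modal → Set where
  hyp  : ∀ {Γ A} → A ∈ Γ → Dₑ Ax Γ A
  ax   : ∀ {Γ A} → Ax A → Dₑ Ax Γ A
  ⊥E   : ∀ {Γ A} → Dₑ Ax Γ ⊥ᶠ → Dₑ Ax Γ A
  dne  : ∀ {Γ A} → Dₑ Ax Γ (¬ᶠ ¬ᶠ A) → Dₑ Ax Γ A
  ∧I   : ∀ {Γ A B} → Dₑ Ax Γ A → Dₑ Ax Γ B → Dₑ Ax Γ (A ∧ᶠ B)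
  ∧E₁  : ∀ {Γ A B} → Dₑ Ax Γ (A ∧ᶠ B) → Dₑ Ax Γ A
  ∧E₂  : ∀ {Γ A B} → Dₑ Ax Γ (A ∧ᶠ B) → Dₑ Ax Γ B
  ∨I₁  : ∀ {Γ A B} → Dₑ Ax Γ A → Dₑ Ax Γ (A ∨ᶠ B)
  ∨I₂  : ∀ {Γ A B} → Dₑ Ax Γ B → Dₑ Ax Γ (A ∨ᶠ B)
  ∨E   : ∀ {Γ A B C} → Dₑ Ax Γ (A ∨ᶠ B) → Dₑ Ax (A ∷ Γ) C → Dₑ Ax (B ∷ Γ) C
         → Dₑ Ax Γ C
  ⊃I   : ∀ {Γ A B} → Dₑ Ax (A ∷ Γ) B → Dₑ Ax Γ (A ⊃ B)
  ⊃E   : ∀ {Γ A B} → Dₑ Ax Γ (A ⊃ B) → Dₑ Ax Γ A → Dₑ Ax Γ B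
  ∀I   : ∀ {Γ A} → Dₑ Ax (map shift Γ) A → Dₑ Ax Γ (∀ᶠ A)
  ∀E   : ∀ {Γ A} (t : Term S) → Dₑ Ax Γ (∀ᶠ A) → Dₑ Ax Γ (A [ t ])
  ∃I   : ∀ {Γ A} (t : Term S) → Dₑ Ax Γ (A [ t ]) → Dₑ Ax Γ (∃ᶠ A)
  ∃E   : ∀ {Γ A B} → Dₑ Ax Γ (∃ᶠ A) → Dₑ Ax (A ∷ map shift Γ) (shift B)
         → Dₑ Ax Γ B
  ≐refl : ∀ {Γ} (t : Term S) → Dₑ Ax Γ (t ≐ t)
  ≐subst : ∀ {Γ A} {s t : Term S} → Dₑ Ax Γ (s ≐ t) → Dₑ Ax Γ (A [ s ])
           → Dₑ Ax Γ (A [ t ])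
  -- □-introduction: the open assumptions Δ actually used are all boxed
  □I   : ∀ {Γ A} (Δ : List (Fm S modal)) → All IsBoxed Δ → All (_∈ Γ) Δ
         → Dₑ Ax Δ A → Dₑ Ax Γ (□ A)
  □E   : ∀ {Γ A} → Dₑ Ax Γ (□ A) → Dₑ Ax Γ A

trRS : ∀ {S} → Fm S plain → Fm S modal
trRS ⊥ᶠ         = ⊥ᶠ
trRS (s ≐ t)    = s ≐ t
trRS (rel P ts) = □ rel P ts
trRS (A ∨ᶠ B)   = (□ trRS A) ∨ᶠ (□ trRS B)
trRS (A ∧ᶠ B)   = trRS A ∧ᶠ trRS B
trRS (A ⊃ B)    = □ ((□ trRS A) ⊃ (□ trRS B))
trRS (∃ᶠ A)     = ∃ᶠ (□ trRS A)
trRS (∀ᶠ A)     = ∀ᶠ (trRS A)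

data AFun : Set where
  zeroF succF plusF timesF : AFun

afunArity : AFun → ℕ
afunArity zeroF  = 0
afunArity succF  = 1
afunArity plusF  = 2
afunArity timesF = 2

Arith : Signature
Arith = record { Fun = AFun ; funArity = afunArity
               ; Pred = ⊥ ; predArity = λ () }

𝟎 : Term Arith
𝟎 = app zeroF []

𝐬 : Term Arith → Term Arith
𝐬 t = app succF (t ∷ [])

_⊕_ : Term Arith → Term Arith → Term Arith
t ⊕ u = app plusF (t ∷ u ∷ [])

_⊗_ : Term Arith → Term Arith → Term Arith
t ⊗ u = app timesF (t ∷ u ∷ [])

stepσ : Subst Arith
stepσ zero    = 𝐬 (var zero)
stepσ (suc n) = var (suc n)

-- Arithmetic axioms (in either language); under ∀ᶠ ∀ᶠ, var 1 = x, var 0 = y.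
-- Induction is for all formulas of the respective language (with parameters).
data ArithAx {m : Mode} : Fm Arith m → Set where
  succ≢0  : ArithAx (∀ᶠ (¬ᶠ (𝐬 (var 0) ≐ 𝟎)))
  succInj : ArithAx (∀ᶠ (∀ᶠ (𝐬 (var 1) ≐ 𝐬 (var 0) ⊃ var 1 ≐ var 0)))
  plus0   : ArithAx (∀ᶠ (var 0 ⊕ 𝟎 ≐ var 0))
  plusS   : ArithAx (∀ᶠ (∀ᶠ (var 1 ⊕ 𝐬 (var 0) ≐ 𝐬 (var 1 ⊕ var 0))))
  times0  : ArithAx (∀ᶠ (var 0 ⊗ 𝟎 ≐ 𝟎))
  timesS  : ArithAx (∀ᶠ (∀ᶠ (var 1 ⊗ 𝐬 (var 0) ≐ (var 1 ⊗ var 0) ⊕ var 1)))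
  ind     : (A : Fm Arith m) →
            ArithAx ((A [ 𝟎 ] ∧ᶠ ∀ᶠ (A ⊃ fsub stepσ A)) ⊃ ∀ᶠ A)

NoAx : ∀ {S m} → Fm S m → Set
NoAx _ = ⊥

IQC⊢_ : ∀ {S} → Fm S plain → Set
IQC⊢ A = Dᵢ NoAx [] A

EQC⊢_ : ∀ {S} → Fm S modal → Set
EQC⊢ A = Dₑ NoAx [] A

HA⊢_ : Fm Arith plain → Set
HA⊢ A = Dᵢ ArithAx [] A

EA⊢_ : Fm Arith modal → Set
EA⊢ A = Dₑ ArithAx [] A

{-# OPTIONS --safe #-}
-- Translate a derivation of A from hypotheses Γ into a derivation of □ A^RS
-- from the boxed hypotheses □ Γ^RS.  Since every open assumption is then boxed,
-- □-introduction is available at each step, which is exactly what the boxes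
-- inserted by the translation at ∨, ⊃ and ∃ require; the translation commutes
-- with substitution, so the quantifier and equality rules carry over verbatim.
-- For HA the translated induction axiom for A is EA induction for □ A^RS.
module Submission where

open import Defs
open import Data.Product using (_×_; _,_)
open import Data.Nat using (zero; suc)
open import Data.Vec using (Vec; []; _∷_)
open import Data.List using (List; []; _∷_; _++_; map)
open import Data.List.Membership.Propositional.Properties using (∈-map⁺)
open import Data.List.Relation.Unary.All using (All; []; _∷_; tabulate)
open import Data.List.Relation.Unary.Any using (here)
open import Function using (id)
open import Relation.Binary.PropositionalEquality
open ≡-Reasoning

module _ {S : Signature} where

  infixr 9 _∘ˢ_

  _∘ˢ_ : Subst S → Subst S → Subst S
  (σ ∘ˢ τ) n = tsub σ (τ n)

  ↑ : Subst S
  ↑ k = var (suc k)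

  _≗ˢ_ : Subst S → Subst S → Set
  σ ≗ˢ τ = ∀ n → σ n ≡ τ n

  mutual
    tsub-cong : ∀ {σ τ} → σ ≗ˢ τ → ∀ t → tsub σ t ≡ tsub τ t
    tsub-cong e (var n)    = e n
    tsub-cong e (app f ts) = cong (app f) (tsubs-cong e ts)

    tsubs-cong : ∀ {σ τ n} → σ ≗ˢ τ → (ts : Vec (Term S) n) → tsubs σ ts ≡ tsubs τ ts
    tsubs-cong e []       = refl
    tsubs-cong e (t ∷ ts) = cong₂ _∷_ (tsub-cong e t) (tsubs-cong e ts)

  mutual
    tsub-∘ : ∀ σ τ t → tsub σ (tsub τ t) ≡ tsub (σ ∘ˢ τ) t
    tsub-∘ σ τ (var n)    = refl
    tsub-∘ σ τ (app f ts) = cong (app f) (tsubs-∘ σ τ ts)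

    tsubs-∘ : ∀ {n} σ τ (ts : Vec (Term S) n) → tsubs σ (tsubs τ ts) ≡ tsubs (σ ∘ˢ τ) ts
    tsubs-∘ σ τ []       = refl
    tsubs-∘ σ τ (t ∷ ts) = cong₂ _∷_ (tsub-∘ σ τ t) (tsubs-∘ σ τ ts)

  mutual
    tsub-var : ∀ t → tsub var t ≡ t
    tsub-var (var n)    = refl
    tsub-var (app f ts) = cong (app f) (tsubs-var ts)

    tsubs-var : ∀ {n} (ts : Vec (Term S) n) → tsubs var ts ≡ ts
    tsubs-var []       = refl
    tsubs-var (t ∷ ts) = cong₂ _∷_ (tsub-var t) (tsubs-var ts)

  liftσ-cong : ∀ {σ τ} → σ ≗ˢ τ → liftσ σ ≗ˢ liftσ τ
  liftσ-cong e zero    = refl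
  liftσ-cong e (suc n) = cong (tsub ↑) (e n)

  liftσ-∘ : ∀ σ τ → (liftσ σ ∘ˢ liftσ τ) ≗ˢ liftσ (σ ∘ˢ τ)
  liftσ-∘ σ τ zero    = refl
  liftσ-∘ σ τ (suc n) = trans (tsub-∘ (liftσ σ) ↑ (τ n)) (sym (tsub-∘ ↑ σ (τ n)))

  liftσ-var : liftσ var ≗ˢ var
  liftσ-var zero    = refl
  liftσ-var (suc n) = refl

  fsub-cong : ∀ {m σ τ} → σ ≗ˢ τ → (A : Fm S m) → fsub σ A ≡ fsub τ A
  fsub-cong e ⊥ᶠ         = refl
  fsub-cong e (s ≐ t)    = cong₂ _≐_ (tsub-cong e s) (tsub-cong e t)
  fsub-cong e (rel P ts) = cong (rel P) (tsubs-cong e ts)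
  fsub-cong e (A ∧ᶠ B)   = cong₂ _∧ᶠ_ (fsub-cong e A) (fsub-cong e B)
  fsub-cong e (A ∨ᶠ B)   = cong₂ _∨ᶠ_ (fsub-cong e A) (fsub-cong e B)
  fsub-cong e (A ⊃ B)    = cong₂ _⊃_ (fsub-cong e A) (fsub-cong e B)
  fsub-cong e (∀ᶠ A)     = cong ∀ᶠ (fsub-cong (liftσ-cong e) A)
  fsub-cong e (∃ᶠ A)     = cong ∃ᶠ (fsub-cong (liftσ-cong e) A)
  fsub-cong e (□ A)      = cong □_ (fsub-cong e A)

  fsub-∘ : ∀ {m} σ τ (A : Fm S m) → fsub σ (fsub τ A) ≡ fsub (σ ∘ˢ τ) A
  fsub-∘ σ τ ⊥ᶠ         = refl
  fsub-∘ σ τ (s ≐ t)    = cong₂ _≐_ (tsub-∘ σ τ s) (tsub-∘ σ τ t)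
  fsub-∘ σ τ (rel P ts) = cong (rel P) (tsubs-∘ σ τ ts)
  fsub-∘ σ τ (A ∧ᶠ B)   = cong₂ _∧ᶠ_ (fsub-∘ σ τ A) (fsub-∘ σ τ B)
  fsub-∘ σ τ (A ∨ᶠ B)   = cong₂ _∨ᶠ_ (fsub-∘ σ τ A) (fsub-∘ σ τ B)
  fsub-∘ σ τ (A ⊃ B)    = cong₂ _⊃_ (fsub-∘ σ τ A) (fsub-∘ σ τ B)
  fsub-∘ σ τ (∀ᶠ A)     = cong ∀ᶠ (trans (fsub-∘ (liftσ σ) (liftσ τ) A)
                                         (fsub-cong (liftσ-∘ σ τ) A))
  fsub-∘ σ τ (∃ᶠ A)     = cong ∃ᶠ (trans (fsub-∘ (liftσ σ) (liftσ τ) A)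
                                         (fsub-cong (liftσ-∘ σ τ) A))
  fsub-∘ σ τ (□ A)      = cong □_ (fsub-∘ σ τ A)

  fsub-var : ∀ {m} (A : Fm S m) → fsub var A ≡ A
  fsub-var ⊥ᶠ         = refl
  fsub-var (s ≐ t)    = cong₂ _≐_ (tsub-var s) (tsub-var t)
  fsub-var (rel P ts) = cong (rel P) (tsubs-var ts)
  fsub-var (A ∧ᶠ B)   = cong₂ _∧ᶠ_ (fsub-var A) (fsub-var B)
  fsub-var (A ∨ᶠ B)   = cong₂ _∨ᶠ_ (fsub-var A) (fsub-var B)
  fsub-var (A ⊃ B)    = cong₂ _⊃_ (fsub-var A) (fsub-var B)
  fsub-var (∀ᶠ A)     = cong ∀ᶠ (trans (fsub-cong liftσ-var A) (fsub-var A))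
  fsub-var (∃ᶠ A)     = cong ∃ᶠ (trans (fsub-cong liftσ-var A) (fsub-var A))
  fsub-var (□ A)      = cong □_ (fsub-var A)

  sub0-var0-liftσ↑ : ∀ {m} (A : Fm S m) → fsub (sub0 (var 0)) (fsub (liftσ ↑) A) ≡ A
  sub0-var0-liftσ↑ A = begin
    fsub (sub0 (var 0)) (fsub (liftσ ↑) A) ≡⟨ fsub-∘ (sub0 (var 0)) (liftσ ↑) A ⟩
    fsub (sub0 (var 0) ∘ˢ liftσ ↑) A       ≡⟨ fsub-cong sub0-var0-∘-liftσ↑ A ⟩
    fsub var A                             ≡⟨ fsub-var A ⟩
    A                                      ∎
    where
    sub0-var0-∘-liftσ↑ : (sub0 (var 0) ∘ˢ liftσ ↑) ≗ˢ var
    sub0-var0-∘-liftσ↑ zero    = refl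
    sub0-var0-∘-liftσ↑ (suc n) = refl

  trRS-fsub : ∀ σ (A : Fm S plain) → trRS (fsub σ A) ≡ fsub σ (trRS A)
  trRS-fsub σ ⊥ᶠ         = refl
  trRS-fsub σ (s ≐ t)    = refl
  trRS-fsub σ (rel P ts) = refl
  trRS-fsub σ (A ∧ᶠ B)   = cong₂ _∧ᶠ_ (trRS-fsub σ A) (trRS-fsub σ B)
  trRS-fsub σ (A ∨ᶠ B)   = cong₂ (λ X Y → □ X ∨ᶠ □ Y) (trRS-fsub σ A) (trRS-fsub σ B)
  trRS-fsub σ (A ⊃ B)    = cong₂ (λ X Y → □ (□ X ⊃ □ Y)) (trRS-fsub σ A) (trRS-fsub σ B)
  trRS-fsub σ (∀ᶠ A)     = cong ∀ᶠ (trRS-fsub (liftσ σ) A)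
  trRS-fsub σ (∃ᶠ A)     = cong (λ X → ∃ᶠ (□ X)) (trRS-fsub (liftσ σ) A)

  trRS□ : Fm S plain → Fm S modal
  trRS□ A = □ trRS A

  trRS□-fsub : ∀ σ (A : Fm S plain) → trRS□ (fsub σ A) ≡ □ fsub σ (trRS A)
  trRS□-fsub σ A = cong □_ (trRS-fsub σ A)

  map-trRS□-shift : (Γ : List (Fm S plain)) →
                    map trRS□ (map shift Γ) ≡ map shift (map trRS□ Γ)
  map-trRS□-shift []      = refl
  map-trRS□-shift (A ∷ Γ) = cong₂ _∷_ (trRS□-fsub ↑ A) (map-trRS□-shift Γ)

  all-boxed-map-trRS□ : (Γ : List (Fm S plain)) → All IsBoxed (map trRS□ Γ)
  all-boxed-map-trRS□ []      = []
  all-boxed-map-trRS□ (A ∷ Γ) = boxed ∷ all-boxed-map-trRS□ Γ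

  module _ {Ax : Fm S modal → Set} where

    □I-boxed : ∀ {Γ A} → All IsBoxed Γ → Dₑ Ax Γ A → Dₑ Ax Γ (□ A)
    □I-boxed bx d = □I _ bx (tabulate id) d

    □I-closed : ∀ {Γ A} → Dₑ Ax [] A → Dₑ Ax Γ (□ A)
    □I-closed = □I [] [] []

    weaken-closed : ∀ {Γ A} → Dₑ Ax [] A → Dₑ Ax Γ A
    weaken-closed d = □E (□I-closed d)

    □I-⊃-□ : ∀ {Γ A B} → Dₑ Ax (□ A ∷ []) B → Dₑ Ax Γ (□ (□ A ⊃ □ B))
    □I-⊃-□ d = □I-closed (⊃I (□I-boxed (boxed ∷ []) d))

    ∀□E : ∀ {Γ A} → Dₑ Ax Γ (∀ᶠ (□ A)) → Dₑ Ax Γ (∀ᶠ A)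
    ∀□E {A = A} = ⊃E (weaken-closed (⊃I (∀I (□E
      (subst (Dₑ Ax _) (cong □_ (sub0-var0-liftσ↑ A)) (∀E (var 0) (hyp (here refl))))))))

    translate : ∀ {Axᵢ : Fm S plain → Set} →
                (∀ {A} → Axᵢ A → Dₑ Ax [] (trRS A)) →
                ∀ {Γ A} → Dᵢ Axᵢ Γ A → Dₑ Ax (map trRS□ Γ) (trRS□ A)
    translate {Axᵢ} axᵢ {Γ} = go
      where
      Γ□ : List (Fm S modal)
      Γ□ = map trRS□ Γ

      □I-Γ : ∀ {A} → Dₑ Ax Γ□ A → Dₑ Ax Γ□ (□ A)
      □I-Γ = □I-boxed (all-boxed-map-trRS□ Γ)

      under-shift : ∀ {Δ A} → Dₑ Ax (Δ ++ map trRS□ (map shift Γ)) A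
                    → Dₑ Ax (Δ ++ map shift Γ□) A
      under-shift {Δ} = subst (λ Θ → Dₑ Ax (Δ ++ Θ) _) (map-trRS□-shift Γ)

      go : ∀ {A} → Dᵢ Axᵢ Γ A → Dₑ Ax Γ□ (trRS□ A)
      go (hyp x)    = hyp (∈-map⁺ trRS□ x)
      go (ax a)     = □I-closed (axᵢ a)
      go (⊥E d)     = ⊥E (□E (go d))
      go (∧I d e)   = □I-Γ (∧I (□E (go d)) (□E (go e)))
      go (∧E₁ d)    = □I-Γ (∧E₁ (□E (go d)))
      go (∧E₂ d)    = □I-Γ (∧E₂ (□E (go d)))
      go (∨I₁ d)    = □I-Γ (∨I₁ (go d))
      go (∨I₂ d)    = □I-Γ (∨I₂ (go d))
      go (∨E d e f) = ∨E (□E (go d)) (translate axᵢ e) (translate axᵢ f)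
      go (⊃I d)     = □I-Γ (□I-Γ (⊃I (translate axᵢ d)))
      go (⊃E d e)   = ⊃E (□E (□E (go d))) (go e)
      go (∀I d)     = □I-Γ (∀I (□E (under-shift {[]} (translate axᵢ d))))
      go (∀E {A = A} t d) =
        □I-Γ (subst (Dₑ Ax Γ□) (sym (trRS-fsub (sub0 t) A)) (∀E t (□E (go d))))
      go (∃I {A = A} t d) =
        □I-Γ (∃I t (subst (Dₑ Ax Γ□) (trRS□-fsub (sub0 t) A) (go d)))
      go (∃E {B = B} d e) =
        ∃E (□E (go d))
           (subst (Dₑ Ax _) (trRS□-fsub ↑ B) (under-shift {_ ∷ []} (translate axᵢ e)))
      go (≐refl t)  = □I-Γ (≐refl t)
      go (≐subst {A = A} {s} {t} d e) =
        subst (Dₑ Ax Γ□) (sym (trRS□-fsub (sub0 t) A))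
          (≐subst {A = trRS□ A} (□E (go d))
             (subst (Dₑ Ax Γ□) (trRS□-fsub (sub0 s) A) (go e)))

noAx-trRS : ∀ {S} {A : Fm S plain} → NoAx A → Dₑ NoAx [] (trRS A)
noAx-trRS ()

arithAx-trRS : ∀ {A : Fm Arith plain} → ArithAx A → Dₑ ArithAx [] (trRS A)
arithAx-trRS succ≢0  = ∀I (□I-⊃-□ (⊃E (∀E (var 0) (ax succ≢0)) (□E (hyp (here refl)))))
arithAx-trRS succInj =
  ∀I (∀I (□I-⊃-□ (⊃E (∀E (var 0) (∀E (var 1) (ax succInj))) (□E (hyp (here refl))))))
arithAx-trRS plus0   = ax plus0
arithAx-trRS plusS   = ax plusS
arithAx-trRS times0  = ax times0
arithAx-trRS timesS  = ax timesS
arithAx-trRS (ind A) = □I-⊃-□ (∀□E (⊃E (ax (ind (trRS□ A))) (∧I base step)))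
  where
  Γ : List (Fm Arith modal)
  Γ = trRS□ (fsub (sub0 𝟎) A ∧ᶠ ∀ᶠ (A ⊃ fsub stepσ A)) ∷ []

  premise : Dₑ ArithAx Γ (trRS (fsub (sub0 𝟎) A ∧ᶠ ∀ᶠ (A ⊃ fsub stepσ A)))
  premise = □E (hyp (here refl))

  base : Dₑ ArithAx Γ (fsub (sub0 𝟎) (trRS□ A))
  base = □I-boxed (boxed ∷ [])
           (subst (Dₑ ArithAx Γ) (trRS-fsub (sub0 𝟎) A) (∧E₁ premise))

  step : Dₑ ArithAx Γ (∀ᶠ (trRS□ A ⊃ fsub stepσ (trRS□ A)))
  step = subst (λ X → Dₑ ArithAx Γ (∀ᶠ (trRS□ A ⊃ □ X))) (trRS-fsub stepσ A)
           (∀□E (∧E₂ premise))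

theorem2p1 : (∀ (S : Signature) (A : Fm S plain) → IQC⊢ A → EQC⊢ (trRS A))
             × (∀ (A : Fm Arith plain) → HA⊢ A → EA⊢ (trRS A))
theorem2p1 = (λ S A d → □E (translate noAx-trRS d))
           , (λ A d → □E (translate arithAx-trRS d))
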